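{- For every reactive Turing machine $M$, the transition system $\mathcal{T}(M)$ associated with $M$ is computable.
   Context: Fix a finite set $\mathcal{A}$ of action symbols and a symbol $\tau\notin\mathcal{A}$; put $\mathcal{A}_\tau=\mathcal{A}\cup\{\tau\}$. Fix a finite set $\mathcal{D}$ of data symbols and a blank symbol $\Box\notin\mathcal{D}$; put $\mathcal{D}_\Box=\mathcal{D}\cup\{\Box\}$. A reactive Turing machine (RTM) is a quadruple $M=(S,\to,\uparrow,\downarrow)$ with $S$ a finite set of states, $\uparrow\in S$ the initial state, $\downarrow\subseteq S$ the set of final states, and $\to\subseteq S\times\mathcal{D}_\Box\times\mathcal{A}_\tau\times\mathcal{D}_\Box\times\{L,R\}\times S$; we write $s\xrightarrow{d/a/e,\,X}t$ for $(s,d,a,e,X,t)\in\to$. An ($\mathcal{A}_\tau$-labelled) transition system is a quadruple $T=(S,\to,\uparrow,\downarrow)$ with $S$ a set of states, $\to\subseteq S\times\mathcal{A}_\tau\times S$, initial state $\uparrow\in S$ and final states $\downarrow\subseteq S$. A tape instance is a finite sequence over $\mathcal{D}_\Box\cup\{\check d\mid d\in\mathcal{D}_\Box\}$ containing exactly one marked symbol $\check d$ (marking the head position); tape instances that differ only by blanks added or removed at either end are identified. For $\delta\in\mathcal{D}_\Box^*$, $\overleftarrow{\delta}$ denotes $\delta$ with its rightmost symbol marked (or $\check\Box$ if $\delta$ is empty), and $\overrightarrow{\delta}$ denotes $\delta$ with its leftmost symbol marked (or $\check\Box$ if $\delta$ is empty). The transition system $\mathcal{T}(M)$ has as states the configurations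 $(s,\delta)$ with $s\in S$ and $\delta$ a tape instance; transitions are given by $(s,\delta_L\check d\delta_R)\xrightarrow{a}(t,\overleftarrow{\delta_L}e\delta_R)$ iff $s\xrightarrow{d/a/e,\,L}t$, and $(s,\delta_L\check d\delta_R)\xrightarrow{a}(t,\delta_Le\overrightarrow{\delta_R})$ iff $s\xrightarrow{d/a/e,\,R}t$ (for $\delta_L,\delta_R\in\mathcal{D}_\Box^*$); its initial state is $(\uparrow,\check\Box)$ and its final states are the $(s,\delta)$ with $s\in\downarrow$. For a transition system, $\mathit{out}(s)=\{(a,t)\mid s\xrightarrow{a}t\}$; it is finitely branching if every $\mathit{out}(s)$ is finite. Fixing injective codings of $\mathcal{A}_\tau$ and of the states into $\mathbb{N}$ (with standard codings of tuples and finite sets), a finitely branching transition system is computable if $\mathit{out}$ and the characteristic function $\mathit{fin}$ of the set of final states are recursive functions. -}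

module Defs where

open import Data.Nat using (ℕ; zero; suc; _+_; _<_; _/_; _%_)
open import Data.Fin using (Fin; toℕ)
open import Data.Fin.Subset using (Subset) renaming (_∈_ to _∈ₛ_)
open import Data.Vec using (Vec; []; _∷_)
open import Data.List using (List; []; _∷_; _++_; [_]; reverse)
open import Data.List.Membership.Propositional using (_∈_)
open import Data.Maybe using (Maybe; nothing; just)
open import Data.Product using (Σ; _×_; _,_; ∃)
open import Relation.Binary.PropositionalEquality using (_≡_)
open import Relation.Nullary using (¬_)

tri : ℕ → ℕ
tri zero    = zero
tri (suc k) = suc k + tri k

⟪_,_⟫ : ℕ → ℕ → ℕ
⟪ a , b ⟫ = tri (a + b) + b

bit : ℕ → ℕ → ℕ
bit n zero    = n % 2
bit n (suc x) = bit (n / 2) x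

-- n is the standard code (Σ_{x ∈ P} 2^x) of the finite set P ⊆ ℕ
CodesSet : ℕ → (ℕ → Set) → Set
CodesSet n P = ∀ x → (bit n x ≡ 1 → P x) × (P x → bit n x ≡ 1)

data PR : ℕ → Set where
  Z : ∀ {n} → PR n
  S : PR 1
  P : ∀ {n} → Fin n → PR n
  C : ∀ {m n} → PR m → Vec (PR n) m → PR n
  R : ∀ {n} → PR n → PR (suc (suc n)) → PR (suc n)   -- primitive recursion (on 1st arg)
  M : ∀ {n} → PR (suc n) → PR n                      -- minimisation (on 1st arg)

lookupV : ∀ {A : Set} {n} → Vec A n → Fin n → A
lookupV (x ∷ xs) Fin.zero    = x
lookupV (x ∷ xs) (Fin.suc i) = lookupV xs i

mutual
  data _⟨_⟩⇓_ : ∀ {n} → PR n → Vec ℕ n → ℕ → Set where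
    Z⇓ : ∀ {n} {xs : Vec ℕ n} → Z ⟨ xs ⟩⇓ 0
    S⇓ : ∀ {x} → S ⟨ x ∷ [] ⟩⇓ suc x
    P⇓ : ∀ {n} {i : Fin n} {xs} → P i ⟨ xs ⟩⇓ lookupV xs i
    C⇓ : ∀ {m n} {f : PR m} {gs : Vec (PR n) m} {xs ys y} →
         gs ⟨ xs ⟩⇓* ys → f ⟨ ys ⟩⇓ y → C f gs ⟨ xs ⟩⇓ y
    R0⇓ : ∀ {n} {f : PR n} {g} {xs y} → f ⟨ xs ⟩⇓ y → R f g ⟨ 0 ∷ xs ⟩⇓ y
    RS⇓ : ∀ {n} {f : PR n} {g} {xs k r y} →
          R f g ⟨ k ∷ xs ⟩⇓ r → g ⟨ k ∷ r ∷ xs ⟩⇓ y → R f g ⟨ suc k ∷ xs ⟩⇓ y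
    M⇓ : ∀ {n} {f : PR (suc n)} {xs y} →
         f ⟨ y ∷ xs ⟩⇓ 0 →
         (∀ z → z < y → Σ ℕ (λ w → f ⟨ z ∷ xs ⟩⇓ suc w)) →
         M f ⟨ xs ⟩⇓ y

  data _⟨_⟩⇓*_ : ∀ {m n} → Vec (PR n) m → Vec ℕ n → Vec ℕ m → Set where
    []⇓ : ∀ {n} {xs : Vec ℕ n} → [] ⟨ xs ⟩⇓* []
    ∷⇓  : ∀ {m n} {g : PR n} {gs : Vec (PR n) m} {xs y ys} →
          g ⟨ xs ⟩⇓ y → gs ⟨ xs ⟩⇓* ys → (g ∷ gs) ⟨ xs ⟩⇓* (y ∷ ys)

Recursive : (ℕ → ℕ) → Set
Recursive f = Σ (PR 1) (λ p → ∀ n → p ⟨ n ∷ [] ⟩⇓ f n)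

-- Symbols: 𝒜 = Fin nA, 𝒜_τ = Maybe (Fin nA) (nothing = τ);
--          𝒟 = Fin nD, 𝒟_□ = Maybe (Fin nD) (nothing = □)

Act : ℕ → Set
Act nA = Maybe (Fin nA)

τ : ∀ {nA} → Act nA
τ = nothing

Dat : ℕ → Set
Dat nD = Maybe (Fin nD)

□ : ∀ {nD} → Dat nD
□ = nothing

codeAct : ∀ {nA} → Act nA → ℕ
codeAct nothing  = 0
codeAct (just a) = suc (toℕ a)

-- Transition systems (states form a setoid: states are given by
-- representatives, _≈_ is the identification of representatives)

record TS (nA : ℕ) : Set₁ where
  field
    State   : Set
    _≈_     : State → State → Set
    _—[_]→_ : State → Act nA → State → Set
    initial : State
    Final   : State → Set

-- Computability of a (finitely branching) transition system w.r.t. the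
-- fixed action coding and a state coding cS (injective on states,
-- i.e. on ≈-classes).
IsComputable : ∀ {nA} (T : TS nA) → (TS.State T → ℕ) → Set
IsComputable T cS =
    (∀ s t → (cS s ≡ cS t → s ≈ t) × (s ≈ t → cS s ≡ cS t))
  × Σ (ℕ → ℕ) (λ out → Recursive out ×
      (∀ s → CodesSet (out (cS s))
               (λ x → Σ (Act _) λ a → Σ State λ t →
                        (s —[ a ]→ t) × (x ≡ ⟪ codeAct a , cS t ⟫))))
  × Σ (ℕ → ℕ) (λ fin → Recursive fin ×
      (∀ s → (Final s → fin (cS s) ≡ 1) × (¬ Final s → fin (cS s) ≡ 0)))
  where open TS T

data Dir : Set where
  L R : Dir

record RTM (nA nD : ℕ) : Set where
  field
    nS     : ℕ
    start  : Fin nS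
    final  : Subset nS
    trans  : List (Fin nS × Dat nD × Act nA × Dat nD × Dir × Fin nS)

-- A tape instance δ_L ď δ_R is represented by the triple (δ_L , d , δ_R).
record Tape (nD : ℕ) : Set where
  constructor tape
  field
    left  : List (Dat nD)
    hd    : Dat nD
    right : List (Dat nD)

splitLast : ∀ {A : Set} → List A → Maybe (List A × A)
splitLast []       = nothing
splitLast (x ∷ xs) with splitLast xs
... | nothing        = just ([] , x)
... | just (ys , y)  = just (x ∷ ys , y)

moveTape : ∀ {nD} → Dir → List (Dat nD) → Dat nD → List (Dat nD) → Tape nD
moveTape L δL e δR with splitLast δL
... | nothing         = tape [] □ (e ∷ δR)
... | just (δL' , c)  = tape δL' c (e ∷ δR)
moveTape R δL e []        = tape (δL ++ [ e ]) □ []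
moveTape R δL e (c ∷ δR)  = tape (δL ++ [ e ]) c δR

-- identification of tape instances differing only by blanks at the ends
dropBlanks : ∀ {nD} → List (Dat nD) → List (Dat nD)
dropBlanks []             = []
dropBlanks (nothing ∷ xs) = dropBlanks xs
dropBlanks (just d ∷ xs)  = just d ∷ xs

normTape : ∀ {nD} → Tape nD → Tape nD
normTape (tape l d r) = tape (dropBlanks l) d (reverse (dropBlanks (reverse r)))

module _ {nA nD : ℕ} (M : RTM nA nD) where
  open RTM M

  Config : Set
  Config = Fin nS × Tape nD

  _≈ᶜ_ : Config → Config → Set
  (s , δ) ≈ᶜ (t , δ') = (s ≡ t) × (normTape δ ≡ normTape δ')

  -- transitions on representatives
  RawStep : Config → Act nA → Config → Set
  RawStep (s , tape δL d δR) a (t , δ') =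
    Σ (Dat nD) λ e → Σ Dir λ X →
      ((s , d , a , e , X , t) ∈ trans) × (δ' ≡ moveTape X δL e δR)

  -- transitions between (classes of) configurations
  Step : Config → Act nA → Config → Set
  Step c a c' = Σ Config λ c₁ → Σ Config λ c₁' →
                  (c ≈ᶜ c₁) × (c' ≈ᶜ c₁') × RawStep c₁ a c₁'

  𝒯 : TS nA
  𝒯 = record
    { State   = Config
    ; _≈_     = _≈ᶜ_
    ; _—[_]→_ = Step
    ; initial = start , tape [] □ []
    ; Final   = λ c → Data.Product.proj₁ c ∈ₛ final
    }

module Submission where

-- A configuration (s , δ_L ď δ_R) is coded, with Cantor pairing, as
-- ⟪ s , ⟪ δ_L , ⟪ d , δ_R ⟫ ⟫ ⟫, where each side of the tape is coded as a stack of
-- symbols read from the head outwards.  Pushing a blank onto the empty stack leaves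
-- it empty, so the code forgets exactly the blanks at the far ends of the tape: it
-- is injective on identified configurations.  State, head symbol and the codes of
-- the tape after a move (pop one stack, push onto the other) are recovered from a
-- code by μ-recursive programs.  Each rule of M then yields a guard, zero iff the
-- rule applies to the coded configuration, and the code ⟪ action , target ⟫ of the
-- resulting transition; a general lemma shows that the binary code of the set of
-- values with vanishing guard is computable and correct.

open import Defs
open import Data.Nat using (ℕ; zero; suc; _+_; _*_; _∸_; _^_; _≤_; _<_; z≤n; s≤s; pred; _/_; _%_; _≟_)
open import Data.Nat.Properties
open import Data.Nat.DivMod
open import Data.Nat.Divisibility using (divides-refl)
open import Data.Bool using (Bool; true; false; if_then_else_)
open import Data.Fin using (Fin; toℕ; #_) renaming (zero to fzero; suc to fsuc)
open import Data.Fin.Properties using (toℕ-injective)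
open import Data.Vec using (Vec; []; _∷_; _[_]=_) renaming (here to hereᵛ; there to thereᵛ)
open import Data.List using (List; []; _∷_; [_]; _∷ʳ_; reverse; map)
open import Data.List.Properties using (unfold-reverse; reverse-++; reverse-involutive; reverse-injective)
open import Data.List.Membership.Propositional using (_∈_)
open import Data.List.Membership.Propositional.Properties using (∈-map⁺; ∈-map⁻)
open import Data.List.Relation.Unary.Any using (here; there)
open import Data.Maybe using (nothing; just)
open import Data.Product using (Σ; _×_; _,_; ∃; ∃₂; proj₁; proj₂)
open import Data.Sum using (_⊎_; inj₁; inj₂)
open import Data.Empty using (⊥-elim)
open import Function using (_$_; _∘_)
open import Function.Bundles using (_⇔_; mk⇔; Equivalence)
open import Relation.Nullary using (¬_; yes; no)
open import Relation.Binary.PropositionalEquality hiding ([_])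

Computable : ∀ {n} → (Vec ℕ n → ℕ) → Set
Computable {n} F = Σ (PR n) λ p → ∀ xs → p ⟨ xs ⟩⇓ F xs

-- Curried variants for operations of arity one, two and three (records, so that
-- the operation is determined by the type).
record Computable₁ (f : ℕ → ℕ) : Set where
  constructor computable₁
  field program : Computable {1} (λ xs → f (lookupV xs (# 0)))

record Computable₂ (f : ℕ → ℕ → ℕ) : Set where
  constructor computable₂
  field program : Computable {2} (λ xs → f (lookupV xs (# 0)) (lookupV xs (# 1)))

record Computable₃ (f : ℕ → ℕ → ℕ → ℕ) : Set where
  constructor computable₃
  field program : Computable {3} (λ xs → f (lookupV xs (# 0)) (lookupV xs (# 1)) (lookupV xs (# 2)))

recursive : ∀ {f} → Computable₁ f → Recursive f
recursive (computable₁ (p , p-ok)) = p , λ n → p-ok (n ∷ [])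

arg : ∀ {n} (i : Fin n) → Computable (λ xs → lookupV xs i)
arg i = P i , λ _ → P⇓

apply₁ : ∀ {n f} {F : Vec ℕ n → ℕ} → Computable₁ f → Computable F → Computable (λ xs → f (F xs))
apply₁ (computable₁ (p , p-ok)) (q , q-ok) = C p (q ∷ []) , λ xs → C⇓ (∷⇓ (q-ok xs) []⇓) (p-ok _)

apply₂ : ∀ {n f} {F G : Vec ℕ n → ℕ} → Computable₂ f → Computable F → Computable G →
         Computable (λ xs → f (F xs) (G xs))
apply₂ (computable₂ (p , p-ok)) (q , q-ok) (r , r-ok) =
  C p (q ∷ r ∷ []) , λ xs → C⇓ (∷⇓ (q-ok xs) (∷⇓ (r-ok xs) []⇓)) (p-ok _)

apply₃ : ∀ {n f} {F G H : Vec ℕ n → ℕ} → Computable₃ f → Computable F → Computable G → Computable H →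
         Computable (λ xs → f (F xs) (G xs) (H xs))
apply₃ (computable₃ (p , p-ok)) (q , q-ok) (r , r-ok) (s , s-ok) =
  C p (q ∷ r ∷ s ∷ []) , λ xs → C⇓ (∷⇓ (q-ok xs) (∷⇓ (r-ok xs) (∷⇓ (s-ok xs) []⇓))) (p-ok _)

primRec : ∀ {n} {F : Vec ℕ n → ℕ} {G : Vec ℕ (suc (suc n)) → ℕ} (h : Vec ℕ (suc n) → ℕ) →
          Computable F → Computable G →
          (∀ xs → h (0 ∷ xs) ≡ F xs) → (∀ k xs → h (suc k ∷ xs) ≡ G (k ∷ h (k ∷ xs) ∷ xs)) →
          Computable h
primRec h (p , p-ok) (q , q-ok) base step = R p q , λ { (k ∷ xs) → run k xs }
  where
  run : ∀ k xs → R p q ⟨ k ∷ xs ⟩⇓ h (k ∷ xs)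
  run zero    xs = subst (R p q ⟨ 0 ∷ xs ⟩⇓_) (sym (base xs)) (R0⇓ (p-ok xs))
  run (suc k) xs = subst (R p q ⟨ suc k ∷ xs ⟩⇓_) (sym (step k xs)) (RS⇓ (run k xs) (q-ok _))

input : Computable {1} (λ xs → lookupV xs (# 0))
input = arg (# 0)

successor : Computable₁ suc
successor = computable₁ $ S , λ { (x ∷ []) → S⇓ }

const : ∀ {n} k → Computable {n} (λ _ → k)
const zero    = Z , λ _ → Z⇓
const (suc k) = apply₁ successor (const k)

add : Computable₂ _+_
add = computable₂ $ primRec _ (arg (# 0)) (apply₁ successor (arg (# 1))) (λ _ → refl) (λ _ _ → refl)

predecessor : Computable₁ pred
predecessor = computable₁ $ primRec _ (const 0) (arg (# 0)) (λ _ → refl) (λ _ _ → refl)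

monus : Computable₂ _∸_
monus = computable₂ $ apply₂ subtractFrom (arg (# 1)) (arg (# 0))
  where
  -- x ∸ suc y = pred (x ∸ y): recursion on the subtrahend.
  subtractFrom : Computable₂ (λ y x → x ∸ y)
  subtractFrom = computable₂ $ primRec _ (arg (# 0)) (apply₁ predecessor (arg (# 1))) (λ _ → refl)
                   (λ { k (x ∷ []) → sym (pred[m∸n]≡m∸[1+n] x k) })

-- 2 ^ suc k unfolds to 2 ^ k + (2 ^ k + 0).
power2 : Computable₁ (2 ^_)
power2 = computable₁ $ primRec _ (const 1) (apply₂ add (arg (# 1)) (arg (# 1))) (λ _ → refl)
           (λ k _ → cong (2 ^ k +_) (+-identityʳ (2 ^ k)))

triangle : Computable₁ tri
triangle = computable₁ $ primRec _ (const 0) (apply₂ add (apply₁ successor (arg (# 0))) (arg (# 1)))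
             (λ _ → refl) (λ _ _ → refl)

atMost : ℕ → ℕ → ℕ
atMost a b = 1 ∸ (a ∸ b)

atMost-≤ : ∀ {a b} → a ≤ b → atMost a b ≡ 1
atMost-≤ {b = b} z≤n   = cong (1 ∸_) (0∸n≡0 b)
atMost-≤ (s≤s a≤b)     = atMost-≤ a≤b

atMost-> : ∀ {a b} → b < a → atMost a b ≡ 0
atMost-> {suc a} {zero}  _           = 0∸n≡0 a
atMost-> {suc a} {suc b} (s≤s b<a)   = atMost-> b<a

triangles : ℕ → ℕ → ℕ
triangles zero    n = 0
triangles (suc k) n = triangles k n + atMost (tri (suc k)) n

-- The diagonal of n: the t with tri t ≤ n < tri (suc t).  Unpairing reads off the
-- second component as the offset of n on its diagonal.
diagonal π₁ π₂ : ℕ → ℕ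
diagonal n = triangles n n
π₂ n = n ∸ tri (diagonal n)
π₁ n = diagonal n ∸ π₂ n

tri-mono : ∀ {m n} → m ≤ n → tri m ≤ tri n
tri-mono z≤n       = z≤n
tri-mono (s≤s m≤n) = +-mono-≤ (s≤s m≤n) (tri-mono m≤n)

n≤tri : ∀ n → n ≤ tri n
n≤tri zero    = z≤n
n≤tri (suc n) = m≤m+n (suc n) (tri n)

-- On a code tri t + b with b ≤ t exactly the triangles tri 1, …, tri t are ≤ the
-- code, so triangles counts t of them.
module _ {t b : ℕ} (b≤t : b ≤ t) where
  private
    N : ℕ
    N = tri t + b

  triangles-below : ∀ k → k ≤ t → triangles k N ≡ k
  triangles-below zero    _   = refl
  triangles-below (suc k) k<t = begin
    triangles k N + atMost (tri (suc k)) N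
      ≡⟨ cong₂ _+_ (triangles-below k (<⇒≤ k<t)) (atMost-≤ tri[k+1]≤N) ⟩
    k + 1  ≡⟨ +-comm k 1 ⟩
    suc k  ∎
    where
    open ≡-Reasoning
    tri[k+1]≤N : tri (suc k) ≤ N
    tri[k+1]≤N = ≤-trans (tri-mono k<t) (m≤m+n (tri t) b)

  code<tri : ∀ d → N < tri (suc (t + d))
  code<tri d = begin-strict
    tri t + b          <⟨ s≤s (+-monoʳ-≤ (tri t) b≤t) ⟩
    suc (tri t + t)    ≡⟨ cong suc (+-comm (tri t) t) ⟩
    tri (suc t)        ≤⟨ tri-mono (s≤s (m≤m+n t d)) ⟩
    tri (suc (t + d))  ∎
    where open ≤-Reasoning

  triangles-above : ∀ d → triangles (t + d) N ≡ t
  triangles-above zero    = trans (cong (λ k → triangles k N) (+-identityʳ t)) (triangles-below t ≤-refl)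
  triangles-above (suc d) = begin
    triangles (t + suc d) N                             ≡⟨ cong (λ k → triangles k N) (+-suc t d) ⟩
    triangles (t + d) N + atMost (tri (suc (t + d))) N  ≡⟨ cong₂ _+_ (triangles-above d) (atMost-> (code<tri d)) ⟩
    t + 0                                               ≡⟨ +-identityʳ t ⟩
    t                                                   ∎
    where open ≡-Reasoning

  diagonal-code : diagonal N ≡ t
  diagonal-code = begin
    triangles N N            ≡⟨ cong (λ k → triangles k N) (m+[n∸m]≡n t≤N) ⟨
    triangles (t + (N ∸ t)) N ≡⟨ triangles-above (N ∸ t) ⟩
    t                        ∎
    where
    open ≡-Reasoning
    t≤N : t ≤ N
    t≤N = ≤-trans (n≤tri t) (m≤m+n (tri t) b)

diagonal-pair : ∀ a b → diagonal ⟪ a , b ⟫ ≡ a + b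
diagonal-pair a b = diagonal-code (m≤n+m b a)

π₂-pair : ∀ a b → π₂ ⟪ a , b ⟫ ≡ b
π₂-pair a b rewrite diagonal-pair a b = m+n∸m≡n (tri (a + b)) b

π₁-pair : ∀ a b → π₁ ⟪ a , b ⟫ ≡ a
π₁-pair a b rewrite π₂-pair a b | diagonal-pair a b = m+n∸n≡m a b

pair-injective : ∀ {a b c d} → ⟪ a , b ⟫ ≡ ⟪ c , d ⟫ → a ≡ c × b ≡ d
pair-injective {a} {b} {c} {d} eq =
  trans (sym (π₁-pair a b)) (trans (cong π₁ eq) (π₁-pair c d)) ,
  trans (sym (π₂-pair a b)) (trans (cong π₂ eq) (π₂-pair c d))

pairing : Computable₂ ⟪_,_⟫
pairing = computable₂ $ apply₂ add (apply₁ triangle (apply₂ add (arg (# 0)) (arg (# 1)))) (arg (# 1))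

diagonalC : Computable₁ diagonal
diagonalC = computable₁ $ apply₂ trianglesC input input
  where
  trianglesC : Computable₂ triangles
  trianglesC = computable₂ $ primRec _ (const 0)
    (apply₂ add (arg (# 1))
      (apply₂ monus (const 1) (apply₂ monus (apply₁ triangle (apply₁ successor (arg (# 0)))) (arg (# 2)))))
    (λ _ → refl) (λ _ _ → refl)

unpair₂ : Computable₁ π₂
unpair₂ = computable₁ $ apply₂ monus input (apply₁ triangle (apply₁ diagonalC input))

unpair₁ : Computable₁ π₁
unpair₁ = computable₁ $ apply₂ monus (apply₁ diagonalC input) (apply₁ unpair₂ input)

ifz : ℕ → ℕ → ℕ → ℕ
ifz zero    a b = a
ifz (suc _) a b = b

dist : ℕ → ℕ → ℕ
dist x y = (x ∸ y) + (y ∸ x)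

dist-self : ∀ x → dist x x ≡ 0
dist-self x rewrite n∸n≡0 x = refl

dist≡0⇒≡ : ∀ {x y} → dist x y ≡ 0 → x ≡ y
dist≡0⇒≡ {x} {y} e =
  ≤-antisym (m∸n≡0⇒m≤n (m+n≡0⇒m≡0 (x ∸ y) e)) (m∸n≡0⇒m≤n (m+n≡0⇒n≡0 (x ∸ y) e))

ifzC : Computable₃ ifz
ifzC = computable₃ $ primRec _ (arg (# 0)) (arg (# 3)) (λ _ → refl) (λ _ _ → refl)

distC : Computable₂ dist
distC = computable₂ $ apply₂ add (apply₂ monus (arg (# 0)) (arg (# 1))) (apply₂ monus (arg (# 1)) (arg (# 0)))

private
  %2-suc : ∀ n → n % 2 ≡ 0 → (n + 1) % 2 ≡ 1
  %2-suc n even = trans (%-distribˡ-+ n 1 2) (cong (λ r → (r + 1) % 2) even)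

  /2-suc : ∀ n → n % 2 ≡ 0 → (n + 1) / 2 ≡ n / 2
  /2-suc n even = trans (+-distrib-/ n 1 (subst (λ r → r + 1 < 2) (sym even) (s≤s (s≤s z≤n))))
                        (+-identityʳ (n / 2))

  %2-+even : ∀ n k → (n + 2 * k) % 2 ≡ n % 2
  %2-+even n k rewrite *-comm 2 k = [m+kn]%n≡m%n n k 2

  /2-+even : ∀ n k → (n + 2 * k) / 2 ≡ n / 2 + k
  /2-+even n k rewrite *-comm 2 k = trans (+-distrib-/-∣ʳ n (divides-refl k)) (cong (n / 2 +_) (m*n/n≡m k 2))

bit-of-0 : ∀ x → bit 0 x ≡ 0
bit-of-0 zero    = refl
bit-of-0 (suc x) = bit-of-0 x

bit-0-or-1 : ∀ n x → bit n x ≡ 0 ⊎ bit n x ≡ 1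
bit-0-or-1 n zero with n % 2 | m%n<n n 2
... | 0 | _ = inj₁ refl
... | 1 | _ = inj₂ refl
... | suc (suc _) | s≤s (s≤s ())
bit-0-or-1 n (suc x) = bit-0-or-1 (n / 2) x

bit-set : ∀ x n → bit n x ≡ 0 → bit (n + 2 ^ x) x ≡ 1
bit-set zero    n clear = %2-suc n clear
bit-set (suc x) n clear rewrite /2-+even n (2 ^ x) = bit-set x (n / 2) clear

bit-keep : ∀ x n → bit n x ≡ 0 → ∀ y → y ≢ x → bit (n + 2 ^ x) y ≡ bit n y
bit-keep zero    n clear zero    y≢x = ⊥-elim (y≢x refl)
bit-keep zero    n clear (suc y) _   = cong (λ m → bit m y) (/2-suc n clear)
bit-keep (suc x) n clear zero    _   = %2-+even n (2 ^ x)
bit-keep (suc x) n clear (suc y) y≢x rewrite /2-+even n (2 ^ x) =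
  bit-keep x (n / 2) clear y (y≢x ∘ cong suc)

CodesSet-cong : ∀ {n P Q} → (∀ y → P y ⇔ Q y) → CodesSet n P → CodesSet n Q
CodesSet-cong P⇔Q codes y =
  Equivalence.to (P⇔Q y) ∘ proj₁ (codes y) , proj₂ (codes y) ∘ Equivalence.from (P⇔Q y)

absent-clear : ∀ {n P v} → CodesSet n P → ¬ P v → bit n v ≡ 0
absent-clear {n} {v = v} codes v∉P with bit-0-or-1 n v
... | inj₁ clear = clear
... | inj₂ set   = ⊥-elim (v∉P (proj₁ (codes v) set))

insert-codes : ∀ {n P v} → CodesSet n P → ¬ P v → CodesSet (n + 2 ^ v) (λ y → v ≡ y ⊎ P y)
insert-codes {n} {v = v} codes v∉P y with y ≟ v
... | yes refl = (λ _ → inj₁ refl) , (λ _ → bit-set v n (absent-clear codes v∉P))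
... | no y≢v rewrite bit-keep v n (absent-clear codes v∉P) y y≢v =
  inj₂ ∘ proj₁ (codes y) ,
  λ { (inj₁ v≡y) → ⊥-elim (y≢v (sym v≡y)) ; (inj₂ Py) → proj₂ (codes y) Py }

-- A list of entries (g , v) represents the set of those v whose guard g is 0.
Hit : ℕ × ℕ → ℕ → Set
Hit (g , v) y = g ≡ 0 × v ≡ y

Contributes : List (ℕ × ℕ) → ℕ → Set
Contributes ps y = ∃ λ p → p ∈ ps × Hit p y

hits : ℕ → List (ℕ × ℕ) → ℕ
hits y []             = 0
hits y ((g , v) ∷ ps) = ifz (g + dist v y) 1 0 + hits y ps

-- The code of the represented set: an entry adds 2 ^ v unless v is contributed later on.
setCode : List (ℕ × ℕ) → ℕ
setCode []             = 0
setCode ((g , v) ∷ ps) = setCode ps + ifz (g + hits v ps) (2 ^ v) 0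

hits≡0 : ∀ y ps → hits y ps ≡ 0 → ¬ Contributes ps y
hits≡0 y ((_ , _) ∷ ps) none (_ , here refl , refl , refl) =
  0≢1+n (sym (subst (λ m → ifz m 1 0 + hits y ps ≡ 0) (dist-self y) none))
hits≡0 y ((g , v) ∷ ps) none (p , there p∈ps , hit) with g + dist v y
... | zero  = 0≢1+n (sym none)
... | suc _ = hits≡0 y ps none (p , p∈ps , hit)

hits≢0 : ∀ y ps {k} → hits y ps ≡ suc k → Contributes ps y
hits≢0 y ((g , v) ∷ ps) some with g + dist v y in eq
... | zero  = (g , v) , here refl , m+n≡0⇒m≡0 g eq , dist≡0⇒≡ (m+n≡0⇒n≡0 g eq)
... | suc _ with hits≢0 y ps some
...   | p , p∈ps , hit = p , there p∈ps , hit

-- setCode ps codes the set contributed by ps: a fresh value is inserted, a value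
-- contributed again later on leaves the code unchanged.
setCode-codes : ∀ ps → CodesSet (setCode ps) (Contributes ps)
setCode-codes [] y = (λ set → ⊥-elim (0≢1+n (trans (sym (bit-of-0 y)) set))) , λ ()
setCode-codes ((g , v) ∷ ps) with g + hits v ps in eq
... | zero  = CodesSet-cong (λ y → mk⇔ added (removed y))
                (insert-codes (setCode-codes ps) (hits≡0 v ps (m+n≡0⇒n≡0 g eq)))
  where
  added : ∀ {y} → v ≡ y ⊎ Contributes ps y → Contributes ((g , v) ∷ ps) y
  added (inj₁ v≡y)           = (g , v) , here refl , m+n≡0⇒m≡0 g eq , v≡y
  added (inj₂ (p , p∈ , hit)) = p , there p∈ , hit
  removed : ∀ y → Contributes ((g , v) ∷ ps) y → v ≡ y ⊎ Contributes ps y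
  removed y (p , here refl , _ , v≡y) = inj₁ v≡y
  removed y (p , there p∈ , hit)     = inj₂ (p , p∈ , hit)
... | suc k = subst (λ m → CodesSet m (Contributes ((g , v) ∷ ps))) (sym (+-identityʳ (setCode ps)))
                (CodesSet-cong (λ y → mk⇔ earlier (later y)) (setCode-codes ps))
  where
  earlier : ∀ {y} → Contributes ps y → Contributes ((g , v) ∷ ps) y
  earlier (p , p∈ , hit) = p , there p∈ , hit
  later : ∀ y → Contributes ((g , v) ∷ ps) y → Contributes ps y
  later y (p , here refl , g≡0 , v≡y) =
    subst (Contributes ps) v≡y (hits≢0 v ps (trans (sym (cong (_+ hits v ps) g≡0)) eq))
  later y (p , there p∈ , hit)        = p , p∈ , hit

entries : {Q : Set} → (Q → ℕ → ℕ) → (Q → ℕ → ℕ) → List Q → ℕ → List (ℕ × ℕ)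
entries guard value qs n = map (λ q → guard q n , value q n) qs

module _ {Q : Set} {guard value : Q → ℕ → ℕ}
         (guardC : ∀ q → Computable₁ (guard q)) (valueC : ∀ q → Computable₁ (value q)) where

  private
    hitsC : ∀ {h} → Computable₁ h → ∀ qs → Computable₁ (λ n → hits (h n) (entries guard value qs n))
    hitsC hC []       = computable₁ (const 0)
    hitsC hC (q ∷ qs) = computable₁ $ apply₂ add
      (apply₃ ifzC (apply₂ add (apply₁ (guardC q) input)
                               (apply₂ distC (apply₁ (valueC q) input) (apply₁ hC input)))
                   (const 1) (const 0))
      (apply₁ (hitsC hC qs) input)

  setCodeC : ∀ qs → Computable₁ (λ n → setCode (entries guard value qs n))
  setCodeC []       = computable₁ (const 0)
  setCodeC (q ∷ qs) = computable₁ $ apply₂ add (apply₁ (setCodeC qs) input)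
    (apply₃ ifzC (apply₂ add (apply₁ (guardC q) input) (apply₁ (hitsC (valueC q) qs) input))
                 (apply₁ power2 (apply₁ (valueC q) input)) (const 0))

-- Pushing a symbol code onto a stack code.  Pushing blank onto the empty stack
-- leaves it empty; otherwise the result is one more than the pair, so the pair is
-- recovered from the predecessor.
push : ℕ → ℕ → ℕ
push x c = ifz (x + c) 0 (suc ⟪ x , c ⟫)

top rest : ℕ → ℕ
top  c = π₁ (c ∸ 1)
rest c = π₂ (c ∸ 1)

push-pred : ∀ x c → push x c ∸ 1 ≡ ⟪ x , c ⟫
push-pred zero    zero    = refl
push-pred zero    (suc c) = refl
push-pred (suc x) c       = refl

top-push : ∀ x c → top (push x c) ≡ x
top-push x c = trans (cong π₁ (push-pred x c)) (π₁-pair x c)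

rest-push : ∀ x c → rest (push x c) ≡ c
rest-push x c = trans (cong π₂ (push-pred x c)) (π₂-pair x c)

push-injective : ∀ {x c y d} → push x c ≡ push y d → x ≡ y × c ≡ d
push-injective {x} {c} {y} {d} eq = pair-injective (trans (sym (push-pred x c)) (trans (cong (_∸ 1) eq) (push-pred y d)))

pushC : Computable₂ push
pushC = computable₂ $ apply₃ ifzC (apply₂ add (arg (# 0)) (arg (# 1))) (const 0)
                                  (apply₁ successor (apply₂ pairing (arg (# 0)) (arg (# 1))))

topC : Computable₁ top
topC = computable₁ $ apply₁ unpair₁ (apply₂ monus input (const 1))

restC : Computable₁ rest
restC = computable₁ $ apply₁ unpair₂ (apply₂ monus input (const 1))

splitLast-nothing : ∀ {A : Set} (l : List A) → splitLast l ≡ nothing → l ≡ []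
splitLast-nothing []       _ = refl
splitLast-nothing (x ∷ xs) eq with splitLast xs
splitLast-nothing (x ∷ xs) () | nothing
splitLast-nothing (x ∷ xs) () | just _

splitLast-just : ∀ {A : Set} (l : List A) {l' c} → splitLast l ≡ just (l' , c) → l ≡ l' ∷ʳ c
splitLast-just []       ()
splitLast-just (x ∷ xs) eq with splitLast xs in eq'
splitLast-just (x ∷ xs) refl | nothing       = cong (x ∷_) (splitLast-nothing xs eq')
splitLast-just (x ∷ xs) refl | just (ys , y) = cong (x ∷_) (splitLast-just xs eq')

module _ {nD : ℕ} where

  codeDat : Dat nD → ℕ
  codeDat nothing  = 0
  codeDat (just d) = suc (toℕ d)

  codeDat-injective : ∀ {x y} → codeDat x ≡ codeDat y → x ≡ y
  codeDat-injective {nothing} {nothing} _  = refl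
  codeDat-injective {just d}  {just e}  eq = cong just (toℕ-injective (suc-injective eq))

  listCode : List (Dat nD) → ℕ
  listCode []       = 0
  listCode (x ∷ xs) = push (codeDat x) (listCode xs)

  -- Trailing blanks are invisible to listCode: it identifies lists up to trimEnd.
  trimEnd : List (Dat nD) → List (Dat nD)
  trimEnd xs = reverse (dropBlanks (reverse xs))

  consTrim : Dat nD → List (Dat nD) → List (Dat nD)
  consTrim nothing  []       = []
  consTrim nothing  (y ∷ ys) = nothing ∷ y ∷ ys
  consTrim (just d) ys       = just d ∷ ys

  consTrim-nonempty : ∀ x ys → ys ≢ [] → consTrim x ys ≡ x ∷ ys
  consTrim-nonempty nothing  []      ys≢[] = ⊥-elim (ys≢[] refl)
  consTrim-nonempty nothing  (_ ∷ _) _     = refl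
  consTrim-nonempty (just d) ys      _     = refl

  consTrim-injective : ∀ {x xs y ys} → consTrim x xs ≡ consTrim y ys → x ≡ y × xs ≡ ys
  consTrim-injective {nothing} {[]}    {nothing} {[]}    _    = refl , refl
  consTrim-injective {nothing} {[]}    {nothing} {_ ∷ _} ()
  consTrim-injective {nothing} {[]}    {just _}          ()
  consTrim-injective {nothing} {_ ∷ _} {nothing} {[]}    ()
  consTrim-injective {nothing} {_ ∷ _} {nothing} {_ ∷ _} refl = refl , refl
  consTrim-injective {nothing} {_ ∷ _} {just _}          ()
  consTrim-injective {just _}  {_}     {nothing} {[]}    ()
  consTrim-injective {just _}  {_}     {nothing} {_ ∷ _} ()
  consTrim-injective {just _}  {_}     {just _}          refl = refl , refl

  snocTrim : List (Dat nD) → Dat nD → List (Dat nD)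
  snocTrim []       x = dropBlanks [ x ]
  snocTrim (z ∷ zs) x = z ∷ zs ∷ʳ x

  dropBlanks-snoc : ∀ ys x → dropBlanks (ys ∷ʳ x) ≡ snocTrim (dropBlanks ys) x
  dropBlanks-snoc []             x = refl
  dropBlanks-snoc (nothing ∷ ys) x = dropBlanks-snoc ys x
  dropBlanks-snoc (just d ∷ ys)  x = refl

  reverse-snocTrim : ∀ zs x → reverse (snocTrim zs x) ≡ consTrim x (reverse zs)
  reverse-snocTrim []       nothing  = refl
  reverse-snocTrim []       (just d) = refl
  reverse-snocTrim (z ∷ zs) x        = begin
    reverse ((z ∷ zs) ∷ʳ x)  ≡⟨ reverse-++ (z ∷ zs) [ x ] ⟩
    x ∷ reverse (z ∷ zs)     ≡⟨ consTrim-nonempty x (reverse (z ∷ zs)) nonempty ⟨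
    consTrim x (reverse (z ∷ zs)) ∎
    where
    open ≡-Reasoning
    nonempty : reverse (z ∷ zs) ≢ []
    nonempty eq with reverse-injective {x = z ∷ zs} {y = []} eq
    ... | ()

  trimEnd-cons : ∀ x xs → trimEnd (x ∷ xs) ≡ consTrim x (trimEnd xs)
  trimEnd-cons x xs = begin
    reverse (dropBlanks (reverse (x ∷ xs)))      ≡⟨ cong (reverse ∘ dropBlanks) (unfold-reverse x xs) ⟩
    reverse (dropBlanks (reverse xs ∷ʳ x))       ≡⟨ cong reverse (dropBlanks-snoc (reverse xs) x) ⟩
    reverse (snocTrim (dropBlanks (reverse xs)) x) ≡⟨ reverse-snocTrim (dropBlanks (reverse xs)) x ⟩
    consTrim x (trimEnd xs)                      ∎
    where open ≡-Reasoning

  -- The inductive step: push and consTrim are injective in the same way.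
  push⇔consTrim : ∀ {x y a b t u} → (a ≡ b ⇔ t ≡ u) →
                  (push (codeDat x) a ≡ push (codeDat y) b) ⇔ (consTrim x t ≡ consTrim y u)
  push⇔consTrim a≡b⇔t≡u = mk⇔
    (λ eq → let x≡y , a≡b = push-injective eq
            in  cong₂ consTrim (codeDat-injective x≡y) (Equivalence.to a≡b⇔t≡u a≡b))
    (λ eq → let x≡y , t≡u = consTrim-injective eq
            in  cong₂ push (cong codeDat x≡y) (Equivalence.from a≡b⇔t≡u t≡u))

  -- An empty list behaves as a blank pushed onto the empty list, so all cases
  -- reduce to the inductive step.
  listCode-≡⇔ : ∀ xs ys → (listCode xs ≡ listCode ys) ⇔ (trimEnd xs ≡ trimEnd ys)
  listCode-≡⇔ []       []       = mk⇔ (λ _ → refl) (λ _ → refl)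
  listCode-≡⇔ []       (y ∷ ys) rewrite trimEnd-cons y ys = push⇔consTrim {x = nothing} (listCode-≡⇔ [] ys)
  listCode-≡⇔ (x ∷ xs) []       rewrite trimEnd-cons x xs = push⇔consTrim {y = nothing} (listCode-≡⇔ xs [])
  listCode-≡⇔ (x ∷ xs) (y ∷ ys) rewrite trimEnd-cons x xs | trimEnd-cons y ys =
    push⇔consTrim (listCode-≡⇔ xs ys)

  -- The part left of the head is coded from the head outwards, so leading blanks
  -- are invisible.
  leftCode-≡⇔ : ∀ l l' → (listCode (reverse l) ≡ listCode (reverse l')) ⇔ (dropBlanks l ≡ dropBlanks l')
  leftCode-≡⇔ l l' = mk⇔
    (λ eq → reverse-injective (trans (sym (trimEnd-reverse l)) (trans (Equivalence.to reversed eq) (trimEnd-reverse l'))))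
    (λ eq → Equivalence.from reversed (trans (trimEnd-reverse l) (trans (cong reverse eq) (sym (trimEnd-reverse l')))))
    where
    reversed : (listCode (reverse l) ≡ listCode (reverse l')) ⇔ (trimEnd (reverse l) ≡ trimEnd (reverse l'))
    reversed = listCode-≡⇔ (reverse l) (reverse l')
    trimEnd-reverse : ∀ l → trimEnd (reverse l) ≡ reverse (dropBlanks l)
    trimEnd-reverse l = cong (reverse ∘ dropBlanks) (reverse-involutive l)

  tapeCode : Tape nD → ℕ
  tapeCode (tape l d r) = ⟪ listCode (reverse l) , ⟪ codeDat d , listCode r ⟫ ⟫

  tapeCode-injective : ∀ δ δ' → tapeCode δ ≡ tapeCode δ' → normTape δ ≡ normTape δ'
  tapeCode-injective (tape l d r) (tape l' d' r') eq =
    let l≡l' , hd-r≡ = pair-injective eq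
        d≡d' , r≡r'  = pair-injective hd-r≡
    in  tape-cong (Equivalence.to (leftCode-≡⇔ l l') l≡l') (codeDat-injective d≡d')
                  (Equivalence.to (listCode-≡⇔ r r') r≡r')
    where
    tape-cong : ∀ {l l' d d' r r'} → l ≡ l' → d ≡ d' → r ≡ r' → tape l d r ≡ tape l' d' r'
    tape-cong refl refl refl = refl

  tapeCode-respects : ∀ δ δ' → normTape δ ≡ normTape δ' → tapeCode δ ≡ tapeCode δ'
  tapeCode-respects (tape l d r) (tape l' d' r') eq =
    cong₂ ⟪_,_⟫ (Equivalence.from (leftCode-≡⇔ l l') (cong Tape.left eq))
                (cong₂ ⟪_,_⟫ (cong (codeDat ∘ Tape.hd) eq)
                             (Equivalence.from (listCode-≡⇔ r r') (cong Tape.right eq)))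

  moveL-pops : ∀ l e r → ∃₂ λ l' c → listCode (reverse l) ≡ push (codeDat c) (listCode (reverse l'))
                                   × moveTape L l e r ≡ tape l' c (e ∷ r)
  moveL-pops l e r with splitLast l in eq
  ... | nothing       = [] , nothing , cong (listCode ∘ reverse) (splitLast-nothing l eq) , refl
  ... | just (l' , c) = l' , c , cong listCode (trans (cong reverse (splitLast-just l eq)) (reverse-++ l' [ c ])) , refl

  moveR-pops : ∀ l e r → ∃₂ λ c r' → listCode r ≡ push (codeDat c) (listCode r')
                                   × moveTape R l e r ≡ tape (l ∷ʳ e) c r'
  moveR-pops l e []       = nothing , [] , refl , refl
  moveR-pops l e (c ∷ r') = c , r' , refl , refl

  leftCode-snoc : ∀ l e → listCode (reverse (l ∷ʳ e)) ≡ push (codeDat e) (listCode (reverse l))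
  leftCode-snoc l e = cong listCode (reverse-++ l [ e ])

stateOf leftOf headOf rightOf : ℕ → ℕ
stateOf n = π₁ n
leftOf  n = π₁ (π₂ n)
headOf  n = π₁ (π₂ (π₂ n))
rightOf n = π₂ (π₂ (π₂ n))

leftOfC : Computable₁ leftOf
leftOfC = computable₁ $ apply₁ unpair₁ (apply₁ unpair₂ input)

headOfC : Computable₁ headOf
headOfC = computable₁ $ apply₁ unpair₁ (apply₁ unpair₂ (apply₁ unpair₂ input))

rightOfC : Computable₁ rightOf
rightOfC = computable₁ $ apply₁ unpair₂ (apply₁ unpair₂ (apply₁ unpair₂ input))

movedCode : Dir → ℕ → ℕ → ℕ
movedCode L e n = ⟪ rest (leftOf n) , ⟪ top (leftOf n) , push e (rightOf n) ⟫ ⟫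
movedCode R e n = ⟪ push e (leftOf n) , ⟪ top (rightOf n) , rest (rightOf n) ⟫ ⟫

movedCodeC : ∀ X e → Computable₁ (movedCode X e)
movedCodeC L e = computable₁ $ apply₂ pairing (apply₁ restC (apply₁ leftOfC input))
  (apply₂ pairing (apply₁ topC (apply₁ leftOfC input)) (apply₂ pushC (const e) (apply₁ rightOfC input)))
movedCodeC R e = computable₁ $ apply₂ pairing (apply₂ pushC (const e) (apply₁ leftOfC input))
  (apply₂ pairing (apply₁ topC (apply₁ rightOfC input)) (apply₁ restC (apply₁ rightOfC input)))

module _ {nD : ℕ} where

  configCode : ∀ {nS} → Fin nS × Tape nD → ℕ
  configCode (s , δ) = ⟪ toℕ s , tapeCode δ ⟫

  module _ {nS} (s : Fin nS) (l : List (Dat nD)) (d : Dat nD) (r : List (Dat nD)) where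
    private
      n : ℕ
      n = configCode (s , tape l d r)

      tapeOf : π₂ n ≡ tapeCode (tape l d r)
      tapeOf = π₂-pair (toℕ s) (tapeCode (tape l d r))

      rightPart : π₂ (tapeCode (tape l d r)) ≡ ⟪ codeDat d , listCode r ⟫
      rightPart = π₂-pair (listCode (reverse l)) ⟪ codeDat d , listCode r ⟫

    stateOf-config : stateOf n ≡ toℕ s
    stateOf-config = π₁-pair (toℕ s) (tapeCode (tape l d r))

    leftOf-config : leftOf n ≡ listCode (reverse l)
    leftOf-config rewrite tapeOf = π₁-pair (listCode (reverse l)) _

    headOf-config : headOf n ≡ codeDat d
    headOf-config rewrite tapeOf | rightPart = π₁-pair (codeDat d) (listCode r)

    rightOf-config : rightOf n ≡ listCode r
    rightOf-config rewrite tapeOf | rightPart = π₂-pair (codeDat d) (listCode r)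

    movedCode-correct : ∀ X e → movedCode X (codeDat e) n ≡ tapeCode (moveTape X l e r)
    movedCode-correct L e with moveL-pops l e r
    ... | l' , c , left≡ , moved
      rewrite leftOf-config | rightOf-config | left≡ | moved
            | top-push (codeDat c) (listCode (reverse l')) | rest-push (codeDat c) (listCode (reverse l')) = refl
    movedCode-correct R e with moveR-pops l e r
    ... | c , r' , right≡ , moved
      rewrite leftOf-config | rightOf-config | right≡ | moved | leftCode-snoc l e
            | top-push (codeDat c) (listCode r') | rest-push (codeDat c) (listCode r') = refl

flag : ∀ {k} → Vec Bool k → ℕ → ℕ
flag []       i = 0
flag (b ∷ bs) i = ifz i (if b then 1 else 0) (flag bs (pred i))

flagC : ∀ {k} (bs : Vec Bool k) → Computable₁ (flag bs)
flagC []       = computable₁ (const 0)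
flagC (b ∷ bs) = computable₁ $ apply₃ ifzC input (const (if b then 1 else 0))
                                          (apply₁ (flagC bs) (apply₁ predecessor input))

flag-set : ∀ {k} {bs : Vec Bool k} {i} → bs [ i ]= true → flag bs (toℕ i) ≡ 1
flag-set hereᵛ        = refl
flag-set (thereᵛ set) = flag-set set

flag-clear : ∀ {k} (bs : Vec Bool k) i → ¬ (bs [ i ]= true) → flag bs (toℕ i) ≡ 0
flag-clear (true  ∷ bs) fzero    unset = ⊥-elim (unset hereᵛ)
flag-clear (false ∷ bs) fzero    unset = refl
flag-clear (b     ∷ bs) (fsuc i) unset = flag-clear bs i (unset ∘ thereᵛ)

module Machine {nA nD : ℕ} (M : RTM nA nD) where
  open RTM M renaming (trans to rules)

  Rule : Set
  Rule = Fin nS × Dat nD × Act nA × Dat nD × Dir × Fin nS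

  -- A rule applies to the configuration coded n iff its guard is 0; it then
  -- contributes the code ⟪ action , target configuration ⟫ of the transition.
  guard label : Rule → ℕ → ℕ
  guard (s , d , _ , _ , _ , _) n = dist (stateOf n) (toℕ s) + dist (headOf n) (codeDat d)
  label (_ , _ , a , e , X , t) n = ⟪ codeAct a , ⟪ toℕ t , movedCode X (codeDat e) n ⟫ ⟫

  guardC : ∀ ρ → Computable₁ (guard ρ)
  guardC (s , d , _) = computable₁ $ apply₂ add (apply₂ distC (apply₁ unpair₁ input) (const (toℕ s)))
                                                (apply₂ distC (apply₁ headOfC input) (const (codeDat d)))

  labelC : ∀ ρ → Computable₁ (label ρ)
  labelC (_ , _ , a , e , X , t) = computable₁ $ apply₂ pairing (const (codeAct a))
    (apply₂ pairing (const (toℕ t)) (apply₁ (movedCodeC X (codeDat e)) input))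

  out : ℕ → ℕ
  out n = setCode (entries guard label rules n)

  outC : Computable₁ out
  outC = setCodeC guardC labelC rules

  fin : ℕ → ℕ
  fin n = flag final (stateOf n)

  finC : Computable₁ fin
  finC = computable₁ $ apply₁ (flagC final) (apply₁ unpair₁ input)

  configCode-injective : ∀ c c' → configCode c ≡ configCode c' → _≈ᶜ_ M c c'
  configCode-injective (s , δ) (s' , δ') eq =
    let s≡s' , δ≡δ' = pair-injective eq in toℕ-injective s≡s' , tapeCode-injective δ δ' δ≡δ'

  configCode-respects : ∀ c c' → _≈ᶜ_ M c c' → configCode c ≡ configCode c'
  configCode-respects (s , δ) (s' , δ') (s≡s' , δ≈δ') =
    cong₂ ⟪_,_⟫ (cong toℕ s≡s') (tapeCode-respects δ δ' δ≈δ')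

  module _ (s : Fin nS) (l : List (Dat nD)) (d : Dat nD) (r : List (Dat nD)) where
    private
      n : ℕ
      n = configCode (s , tape l d r)

    guard-config : ∀ s' d' a e X t → guard (s' , d' , a , e , X , t) n ≡ 0 → s' ≡ s × d' ≡ d
    guard-config s' d' _ _ _ _ applies rewrite stateOf-config s l d r | headOf-config s l d r =
      toℕ-injective (sym (dist≡0⇒≡ (m+n≡0⇒m≡0 _ applies))) ,
      codeDat-injective (sym (dist≡0⇒≡ (m+n≡0⇒n≡0 (dist (toℕ s) (toℕ s')) applies)))

    guard-self : ∀ a e X t → guard (s , d , a , e , X , t) n ≡ 0
    guard-self _ _ _ _ rewrite stateOf-config s l d r | headOf-config s l d r =
      cong₂ _+_ (dist-self (toℕ s)) (dist-self (codeDat d))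

    label-config : ∀ s' d' a e X t →
                   label (s' , d' , a , e , X , t) n ≡ ⟪ codeAct a , configCode (t , moveTape X l e r) ⟫
    label-config _ _ a e X t = cong (λ m → ⟪ codeAct a , ⟪ toℕ t , m ⟫ ⟫) (movedCode-correct s l d r X e)

  RawSuccessor : Config M → ℕ → Set
  RawSuccessor c y = ∃₂ λ a c' → RawStep M c a c' × y ≡ ⟪ codeAct a , configCode c' ⟫

  contributes⇔raw : ∀ c y → Contributes (entries guard label rules (configCode c)) y ⇔ RawSuccessor c y
  contributes⇔raw (s , tape l d r) y = mk⇔ to from
    where
    entry : Rule → ℕ × ℕ
    entry ρ = guard ρ (configCode (s , tape l d r)) , label ρ (configCode (s , tape l d r))

    to : Contributes (map entry rules) y → RawSuccessor (s , tape l d r) y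
    to (_ , p∈ , applies , label≡y) with ∈-map⁻ entry p∈
    ... | (s' , d' , a , e , X , t) , ρ∈ , refl with guard-config s l d r s' d' a e X t applies
    ...   | refl , refl = a , (t , moveTape X l e r) , (e , X , ρ∈ , refl) ,
                          trans (sym label≡y) (label-config s l d r s d a e X t)

    from : RawSuccessor (s , tape l d r) y → Contributes (map entry rules) y
    from (a , (t , _) , (e , X , ρ∈ , refl) , y≡) =
      entry (s , d , a , e , X , t) , ∈-map⁺ entry ρ∈ , guard-self s l d r a e X t ,
      trans (label-config s l d r s d a e X t) (sym y≡)

  Successor : Config M → ℕ → Set
  Successor c y = Σ (Act nA) λ a → Σ (Config M) λ c' → Step M c a c' × y ≡ ⟪ codeAct a , configCode c' ⟫

  -- out codes the transitions of 𝒯(M): a transition between identified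
  -- configurations has the same code as one of the representative's raw transitions.
  out-codes : ∀ c → CodesSet (out (configCode c)) (Successor c)
  out-codes c = CodesSet-cong (λ y → mk⇔ (to y) (from y)) (setCode-codes (entries guard label rules (configCode c)))
    where
    to : ∀ y → Contributes (entries guard label rules (configCode c)) y → Successor c y
    to y contributes with Equivalence.to (contributes⇔raw c y) contributes
    ... | a , c' , raw , y≡ = a , c' , (c , c' , (refl , refl) , (refl , refl) , raw) , y≡

    from : ∀ y → Successor c y → Contributes (entries guard label rules (configCode c)) y
    from y (a , c' , (c₁ , c₁' , c≈c₁ , c'≈c₁' , raw) , y≡) =
      subst (λ m → Contributes (entries guard label rules m) y) (sym (configCode-respects c c₁ c≈c₁))
        (Equivalence.from (contributes⇔raw c₁ y)
           (a , c₁' , raw , trans y≡ (cong (λ m → ⟪ codeAct a , m ⟫) (configCode-respects c' c₁' c'≈c₁'))))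

  fin-correct : ∀ c → (TS.Final (𝒯 M) c → fin (configCode c) ≡ 1)
                    × (¬ TS.Final (𝒯 M) c → fin (configCode c) ≡ 0)
  fin-correct (s , δ) = (λ s-final → trans state≡ (flag-set s-final)) ,
                        (λ s-not-final → trans state≡ (flag-clear final s s-not-final))
    where
    state≡ : fin (configCode (s , δ)) ≡ flag final (toℕ s)
    state≡ = cong (flag final) (π₁-pair (toℕ s) (tapeCode δ))

proposition2 : (nA nD : ℕ) (M : RTM nA nD) →
    Σ (TS.State (𝒯 M) → ℕ) (λ cS → IsComputable (𝒯 M) cS)
proposition2 nA nD machine =
  configCode ,
  (λ c c' → configCode-injective c c' , configCode-respects c c') ,
  (out , recursive outC , out-codes) ,
  (fin , recursive finC , fin-correct)
  where open Machine machine
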